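{- Let $P$ be a finite poset of length $1$ with $|P|\ge2$ whose undirected Hasse diagram is biconnected, and let $r$ be a positive integer. If $P$ has an $r$-Gorenstein labeling, then $P$ has the same number of minimal elements as maximal elements.
   Context: Length $1$ means every element is minimal or maximal and some chain has two elements. For $S\subseteq P$, $cc(S)$ is the number of connected components of the subgraph of the undirected Hasse diagram induced on $S$ ($cc(\varnothing)=0$); for an upset $A$, $\dim(A)=cc(A)+cc(P\setminus A)-1$. An $r$-Gorenstein labeling is $\phi:P\to\mathbb{Z}$ with $\sum_{z\in P}\phi(z)=0$ and $\sum_{z\in A}\phi(z)=r$ for every upset $A$ with $\dim(A)=1$. -}

module Defs where

open import Data.Nat using (ℕ; zero; suc; _<ᵇ_)
open import Data.Bool using (Bool; true; false; _∧_; _∨_; not; if_then_else_)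
open import Data.Fin using (Fin; toℕ)
import Data.Fin as F
open import Data.Integer using (ℤ; +_; _+_)
open import Data.Product using (Σ; ∃; _×_; _,_)
open import Data.Sum using (_⊎_)
open import Relation.Nullary using (¬_)
open import Relation.Nullary.Decidable using (⌊_⌋)
open import Relation.Binary.PropositionalEquality using (_≡_)

record FinPoset : Set where
  field
    n     : ℕ
    lt    : Fin n → Fin n → Bool
    irrefl : ∀ x → lt x x ≡ false
    trans  : ∀ x y z → lt x y ≡ true → lt y z ≡ true → lt x z ≡ true

Subset : ℕ → Set
Subset n = Fin n → Bool

anyF : ∀ {n} → (Fin n → Bool) → Bool
anyF {zero}  f = false
anyF {suc n} f = f F.zero ∨ anyF (λ i → f (F.suc i))

countF : ∀ {n} → (Fin n → Bool) → ℕ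
countF {zero}  f = 0
countF {suc n} f = (if f F.zero then 1 else 0) Data.Nat.+ countF (λ i → f (F.suc i))

sumℤ : ∀ {n} → (Fin n → ℤ) → ℤ
sumℤ {zero}  f = + 0
sumℤ {suc n} f = f F.zero + sumℤ (λ i → f (F.suc i))

eqF : ∀ {n} → Fin n → Fin n → Bool
eqF x y = ⌊ x F.≟ y ⌋

module _ (P : FinPoset) where
  open FinPoset P

  _<P_ : Fin n → Fin n → Set
  x <P y = lt x y ≡ true

  covers : Fin n → Fin n → Bool
  covers x y = lt x y ∧ not (anyF (λ z → lt x z ∧ lt z y))

  hasseAdj : Fin n → Fin n → Bool
  hasseAdj x y = covers x y ∨ covers y x

  reachK : Subset n → ℕ → Fin n → Fin n → Bool
  reachK S zero    x y = S x ∧ eqF x y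
  reachK S (suc k) x y = reachK S k x y ∨ anyF (λ z → reachK S k x z ∧ S y ∧ hasseAdj z y)

  reach : Subset n → Fin n → Fin n → Bool
  reach S = reachK S n

  -- cc(S): number of connected components of the induced subgraph on S,
  -- counted via the representative of least index in each component
  cc : Subset n → ℕ
  cc S = countF (λ x → S x ∧ not (anyF (λ y → (toℕ y <ᵇ toℕ x) ∧ reach S x y)))

  complement : Subset n → Subset n
  complement A x = not (A x)

  IsUpset : Subset n → Set
  IsUpset A = ∀ x y → A x ≡ true → x <P y → A y ≡ true

  dim : Subset n → ℕ
  dim A = cc A Data.Nat.+ cc (complement A) Data.Nat.∸ 1

  Minimal Maximal : Fin n → Set
  Minimal x = ∀ y → ¬ (y <P x)
  Maximal x = ∀ y → ¬ (x <P y)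

  HasLength1 : Set
  HasLength1 = (∀ x → Minimal x ⊎ Maximal x) × (∃ λ x → ∃ λ y → x <P y)

  numMinimal numMaximal : ℕ
  numMinimal = countF (λ x → not (anyF (λ y → lt y x)))
  numMaximal = countF (λ x → not (anyF (λ y → lt x y)))

  all : Subset n
  all _ = true

  HasseBiconnected : Set
  HasseBiconnected = (cc all ≡ 1) × (∀ v → cc (λ x → not (eqF x v)) ≡ 1)

  sumOver : Subset n → (Fin n → ℤ) → ℤ
  sumOver A φ = sumℤ (λ z → if A z then φ z else + 0)

  IsGorensteinLabeling : ℤ → (Fin n → ℤ) → Set
  IsGorensteinLabeling r φ =
    (sumℤ φ ≡ + 0) × (∀ A → IsUpset A → dim A ≡ 1 → sumOver A φ ≡ r)

-- For a maximal x the singleton {x} is an upset, and for a minimal x the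
-- complement P ∖ {x} is an upset.  Both sides of either cut are connected (a
-- singleton trivially, P ∖ {x} by biconnectivity), so these upsets have
-- dimension 1 and an r-Gorenstein labeling φ satisfies φ(max) = r and, as the
-- total sum vanishes, φ(min) = -r.  Since r ≠ -r no element is both minimal and
-- maximal, so in length 1 the minimal elements are exactly the non-maximal
-- ones, and 0 = Σ φ = r · (#max - #min) forces #max = #min.
module Submission where

open import Defs
open import Data.Bool using (Bool; true; false; _∧_; _∨_; not; if_then_else_; T)
open import Data.Bool.Properties using (not-involutive)
open import Data.Empty using (⊥-elim)
open import Data.Fin using (Fin; toℕ; zero; suc; _≟_)
open import Data.Fin.Properties using (suc-injective)
open import Data.Integer using (ℤ; +_; +[1+_]; _+_; _-_; _*_; -_; NonZero)
open import Data.Integer.Properties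
  using (+-identityˡ; +-identityʳ; *-zeroˡ; *-cancelʳ-≡; i-j≡0⇒i≡j; +-injective; +-0-abelianGroup)
open import Algebra.Properties.AbelianGroup +-0-abelianGroup using (inverseˡ-unique)
open import Data.Integer.Tactic.RingSolver using (solve-∀)
open import Data.Nat using (ℕ; _≤_; _<ᵇ_; s≤s; z≤n)
import Data.Nat as ℕ
open import Data.Nat.Properties using (<ᵇ⇒<; n≮n)
open import Data.Product using (Σ; ∃; _×_; _,_; proj₁; proj₂)
open import Data.Sum using (_⊎_; inj₁; inj₂) renaming (map to ⊎-map)
open import Function using (_∘_; _⇔_; mk⇔; Equivalence)
open import Relation.Nullary using (¬_; yes; no)
open import Relation.Binary.PropositionalEquality
  using (_≡_; _≢_; refl; sym; trans; cong; cong₂; subst; module ≡-Reasoning)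

open Equivalence using (to; from)

∧-true⁻ : ∀ {a b} → a ∧ b ≡ true → a ≡ true × b ≡ true
∧-true⁻ {true} {true} _ = refl , refl

∨-true⁻ : ∀ {a b} → a ∨ b ≡ true → a ≡ true ⊎ b ≡ true
∨-true⁻ {true}  _ = inj₁ refl
∨-true⁻ {false} e = inj₂ e

¬true⇒false : ∀ {b} → ¬ (b ≡ true) → b ≡ false
¬true⇒false {true}  h = ⊥-elim (h refl)
¬true⇒false {false} _ = refl

exactly-one⇒≡not : ∀ {b c} → b ≡ true ⊎ c ≡ true → ¬ (b ≡ true × c ≡ true) → b ≡ not c
exactly-one⇒≡not {true}  {true}  _          both = ⊥-elim (both (refl , refl))
exactly-one⇒≡not {true}  {false} _          _    = refl
exactly-one⇒≡not {false} {true}  _          _    = refl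
exactly-one⇒≡not {false} {false} (inj₁ ()) _
exactly-one⇒≡not {false} {false} (inj₂ ()) _

eqF-true⁻ : ∀ {n} {y x : Fin n} → eqF y x ≡ true → y ≡ x
eqF-true⁻ {y = y} {x} e with y ≟ x
... | yes y≡x = y≡x

eqF-false⁺ : ∀ {n} {y x : Fin n} → y ≢ x → eqF y x ≡ false
eqF-false⁺ {y = y} {x} y≢x with y ≟ x
... | yes y≡x = ⊥-elim (y≢x y≡x)
... | no  _   = refl

eqF-refl : ∀ {n} (x : Fin n) → eqF x x ≡ true
eqF-refl x with x ≟ x
... | yes _   = refl
... | no  x≢x = ⊥-elim (x≢x refl)


anyF-false⁺ : ∀ {n} (f : Fin n → Bool) → (∀ y → f y ≡ false) → anyF f ≡ false
anyF-false⁺ {ℕ.zero}  f h = refl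
anyF-false⁺ {ℕ.suc n} f h rewrite h zero = anyF-false⁺ (f ∘ suc) (h ∘ suc)

anyF-false⁻ : ∀ {n} (f : Fin n → Bool) → anyF f ≡ false → ∀ y → f y ≡ false
anyF-false⁻ {ℕ.suc n} f e y with f zero in f0
anyF-false⁻ {ℕ.suc n} f () y       | true
anyF-false⁻ {ℕ.suc n} f e zero    | false = f0
anyF-false⁻ {ℕ.suc n} f e (suc y) | false = anyF-false⁻ (f ∘ suc) e y

anyF-true⁻ : ∀ {n} (f : Fin n → Bool) → anyF f ≡ true → ∃ λ y → f y ≡ true
anyF-true⁻ {ℕ.suc n} f e with f zero in f0
... | true  = zero , f0
... | false with anyF-true⁻ (f ∘ suc) e
...   | y , fy = suc y , fy

not-anyF≡true⇔ : ∀ {n} (f : Fin n → Bool) → not (anyF f) ≡ true ⇔ (∀ y → ¬ (f y ≡ true))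
not-anyF≡true⇔ f = mk⇔ ⇒ ⇐
  where
  ⇒ : not (anyF f) ≡ true → ∀ y → ¬ (f y ≡ true)
  ⇒ e y fy with anyF f in any
  ⇒ () y fy | true
  ... | false with () ← trans (sym (anyF-false⁻ f any y)) fy
  ⇐ : (∀ y → ¬ (f y ≡ true)) → not (anyF f) ≡ true
  ⇐ h = cong not (anyF-false⁺ f (¬true⇒false ∘ h))

anyF-cong : ∀ {n} {f g : Fin n → Bool} → (∀ y → f y ≡ g y) → anyF f ≡ anyF g
anyF-cong {ℕ.zero}  h = refl
anyF-cong {ℕ.suc n} h = cong₂ _∨_ (h zero) (anyF-cong (h ∘ suc))

countF-cong : ∀ {n} {f g : Fin n → Bool} → (∀ y → f y ≡ g y) → countF f ≡ countF g
countF-cong {ℕ.zero}  h = refl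
countF-cong {ℕ.suc n} h =
  cong₂ (λ a b → (if a then 1 else 0) ℕ.+ b) (h zero) (countF-cong (h ∘ suc))

countF-zero : ∀ {n} (f : Fin n → Bool) → (∀ y → f y ≡ false) → countF f ≡ 0
countF-zero {ℕ.zero}  f h = refl
countF-zero {ℕ.suc n} f h rewrite h zero = countF-zero (f ∘ suc) (h ∘ suc)

countF-single : ∀ {n} (f : Fin n → Bool) (x : Fin n) →
  f x ≡ true → (∀ y → y ≢ x → f y ≡ false) → countF f ≡ 1
countF-single {ℕ.suc n} f zero fx h rewrite fx =
  cong ℕ.suc (countF-zero (f ∘ suc) (λ y → h (suc y) (λ ())))
countF-single {ℕ.suc n} f (suc x) fx h rewrite h zero (λ ()) =
  countF-single (f ∘ suc) x fx (λ y y≢x → h (suc y) (y≢x ∘ suc-injective))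

sumℤ-cong : ∀ {n} {f g : Fin n → ℤ} → (∀ y → f y ≡ g y) → sumℤ f ≡ sumℤ g
sumℤ-cong {ℕ.zero}  h = refl
sumℤ-cong {ℕ.suc n} h = cong₂ _+_ (h zero) (sumℤ-cong (h ∘ suc))

sumℤ-zero : ∀ {n} (f : Fin n → ℤ) → (∀ y → f y ≡ + 0) → sumℤ f ≡ + 0
sumℤ-zero {ℕ.zero}  f h = refl
sumℤ-zero {ℕ.suc n} f h rewrite h zero = trans (+-identityˡ _) (sumℤ-zero (f ∘ suc) (h ∘ suc))

sumℤ-single : ∀ {n} (f : Fin n → ℤ) (x : Fin n) → (∀ y → y ≢ x → f y ≡ + 0) → sumℤ f ≡ f x
sumℤ-single {ℕ.suc n} f zero h
  rewrite sumℤ-zero (f ∘ suc) (λ y → h (suc y) (λ ())) = +-identityʳ (f zero)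
sumℤ-single {ℕ.suc n} f (suc x) h rewrite h zero (λ ()) =
  trans (+-identityˡ _) (sumℤ-single (f ∘ suc) x (λ y y≢x → h (suc y) (y≢x ∘ suc-injective)))

sumℤ-+ : ∀ {n} (f g : Fin n → ℤ) → sumℤ (λ z → f z + g z) ≡ sumℤ f + sumℤ g
sumℤ-+ {ℕ.zero}  f g = refl
sumℤ-+ {ℕ.suc n} f g =
  trans (cong (_+_ (f zero + g zero)) (sumℤ-+ (f ∘ suc) (g ∘ suc)))
        (interchange (f zero) (g zero) (sumℤ (f ∘ suc)) (sumℤ (g ∘ suc)))
  where
  interchange : ∀ a b A B → (a + b) + (A + B) ≡ (a + A) + (b + B)
  interchange = solve-∀

sumℤ-if-neg : ∀ {n} (c : Fin n → Bool) (u : ℤ) →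
  sumℤ (λ x → if c x then u else - u) ≡ (+ countF c - + countF (not ∘ c)) * u
sumℤ-if-neg {ℕ.zero}  c u = sym (*-zeroˡ u)
sumℤ-if-neg {ℕ.suc n} c u with c zero
... | true  rewrite sumℤ-if-neg (c ∘ suc) u =
  step u (+ countF (c ∘ suc)) (+ countF (not ∘ c ∘ suc))
  where
  step : ∀ u K K' → u + (K - K') * u ≡ (+ 1 + K - K') * u
  step = solve-∀
... | false rewrite sumℤ-if-neg (c ∘ suc) u =
  step u (+ countF (c ∘ suc)) (+ countF (not ∘ c ∘ suc))
  where
  step : ∀ u K K' → - u + (K - K') * u ≡ (K - (+ 1 + K')) * u
  step = solve-∀

countF-balanced : ∀ {n} (c : Fin n → Bool) (u : ℤ) .{{_ : NonZero u}} →
  sumℤ (λ x → if c x then u else - u) ≡ + 0 → countF c ≡ countF (not ∘ c)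
countF-balanced c u sum≡0 = +-injective (i-j≡0⇒i≡j _ _ difference≡0)
  where
  difference≡0 : + countF c - + countF (not ∘ c) ≡ + 0
  difference≡0 = *-cancelʳ-≡ _ _ u
    (trans (sym (sumℤ-if-neg c u)) (trans sum≡0 (sym (*-zeroˡ u))))

module _ (P : FinPoset) where
  open FinPoset P using (n; lt)

  singleton : Fin n → Subset n
  singleton x z = eqF z x

  isMaximal isMinimal : Fin n → Bool
  isMaximal x = not (anyF (λ y → lt x y))
  isMinimal x = not (anyF (λ y → lt y x))

  isMaximal⇔Maximal : ∀ x → isMaximal x ≡ true ⇔ Maximal P x
  isMaximal⇔Maximal x = not-anyF≡true⇔ (lt x)

  isMinimal⇔Minimal : ∀ x → isMinimal x ≡ true ⇔ Minimal P x
  isMinimal⇔Minimal x = not-anyF≡true⇔ (λ y → lt y x)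

  reachK⇒member : ∀ S k x y → reachK P S k x y ≡ true → S y ≡ true
  reachK⇒member S ℕ.zero x y e with ∧-true⁻ {S x} e
  ... | Sx , x≡y = subst (λ t → S t ≡ true) (eqF-true⁻ x≡y) Sx
  reachK⇒member S (ℕ.suc k) x y e with ∨-true⁻ {reachK P S k x y} e
  ... | inj₁ short = reachK⇒member S k x y short
  ... | inj₂ step with anyF-true⁻ _ step
  ...   | z , last = proj₁ (∧-true⁻ (proj₂ (∧-true⁻ {reachK P S k x z} last)))

  reachK-cong : ∀ {S S'} → (∀ z → S z ≡ S' z) → ∀ k x y → reachK P S k x y ≡ reachK P S' k x y
  reachK-cong S≡S' ℕ.zero x y = cong (_∧ eqF x y) (S≡S' x)
  reachK-cong S≡S' (ℕ.suc k) x y =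
    cong₂ _∨_ (reachK-cong S≡S' k x y)
      (anyF-cong (λ z → cong₂ _∧_ (reachK-cong S≡S' k x z) (cong (_∧ _) (S≡S' y))))

  cc-cong : ∀ {S S'} → (∀ z → S z ≡ S' z) → cc P S ≡ cc P S'
  cc-cong S≡S' = countF-cong λ x → cong₂ _∧_ (S≡S' x)
    (cong not (anyF-cong (λ y → cong ((toℕ y <ᵇ toℕ x) ∧_) (reachK-cong S≡S' n x y))))

  cc-singleton : ∀ x → cc P (singleton x) ≡ 1
  cc-singleton x = countF-single _ x representative others
    where
    noEarlierReachable : ∀ w → ((toℕ w <ᵇ toℕ x) ∧ reach P (singleton x) x w) ≡ false
    noEarlierReachable w with toℕ w <ᵇ toℕ x in w<x | reach P (singleton x) x w in x~w
    ... | false | _     = refl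
    ... | true  | false = refl
    ... | true  | true  with refl ← eqF-true⁻ (reachK⇒member (singleton x) n x w x~w) =
      ⊥-elim (n≮n (toℕ x) (<ᵇ⇒< _ _ (subst T (sym w<x) _)))
    representative :
      (singleton x x ∧ not (anyF (λ w → (toℕ w <ᵇ toℕ x) ∧ reach P (singleton x) x w))) ≡ true
    representative rewrite eqF-refl x | anyF-false⁺ _ noEarlierReachable = refl
    others : ∀ y → y ≢ x →
      (singleton x y ∧ not (anyF (λ w → (toℕ w <ᵇ toℕ y) ∧ reach P (singleton x) y w))) ≡ false
    others y y≢x rewrite eqF-false⁺ y≢x = refl

  module _ (biconnected : HasseBiconnected P) (x : Fin n) where

    dim-singleton : dim P (singleton x) ≡ 1
    dim-singleton = cong₂ (λ a b → a ℕ.+ b ℕ.∸ 1) (cc-singleton x) (proj₂ biconnected x)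

    dim-complement-singleton : dim P (complement P (singleton x)) ≡ 1
    dim-complement-singleton =
      cong₂ (λ a b → a ℕ.+ b ℕ.∸ 1) (proj₂ biconnected x)
        (trans (cc-cong (λ z → not-involutive (eqF z x))) (cc-singleton x))

  singleton-isUpset : ∀ {x} → Maximal P x → IsUpset P (singleton x)
  singleton-isUpset {x} maxx u v u≡x u<v =
    ⊥-elim (maxx v (subst (λ t → lt t v ≡ true) (eqF-true⁻ u≡x) u<v))

  complement-singleton-isUpset : ∀ {x} → Minimal P x → IsUpset P (complement P (singleton x))
  complement-singleton-isUpset {x} minx u v _ u<v with eqF v x in v≡x
  ... | true  = ⊥-elim (minx u (subst (λ t → lt u t ≡ true) (eqF-true⁻ v≡x) u<v))
  ... | false = refl

  sumOver-singleton : ∀ (φ : Fin n → ℤ) x → sumOver P (singleton x) φ ≡ φ x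
  sumOver-singleton φ x = trans (sumℤ-single _ x off) (cong (if_then φ x else + 0) (eqF-refl x))
    where
    off : ∀ y → y ≢ x → (if eqF y x then φ y else + 0) ≡ + 0
    off y y≢x rewrite eqF-false⁺ y≢x = refl

  sumOver-complement : ∀ (φ : Fin n → ℤ) A → sumOver P A φ + sumOver P (complement P A) φ ≡ sumℤ φ
  sumOver-complement φ A = trans (sym (sumℤ-+ inside outside)) (sumℤ-cong split)
    where
    inside outside : Fin n → ℤ
    inside  z = if A z then φ z else + 0
    outside z = if not (A z) then φ z else + 0
    split : ∀ z → inside z + outside z ≡ φ z
    split z with A z
    ... | true  = +-identityʳ (φ z)
    ... | false = +-identityˡ (φ z)

  module GorensteinLabeling (biconnected : HasseBiconnected P)
    {r : ℤ} {φ : Fin n → ℤ} (gorenstein : IsGorensteinLabeling P r φ) where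

    label-maximal : ∀ {x} → Maximal P x → φ x ≡ r
    label-maximal {x} maxx = begin
      φ x                        ≡⟨ sym (sumOver-singleton φ x) ⟩
      sumOver P (singleton x) φ  ≡⟨ proj₂ gorenstein _ (singleton-isUpset maxx)
                                                    (dim-singleton biconnected x) ⟩
      r                          ∎
      where open ≡-Reasoning

    label-minimal : ∀ {x} → Minimal P x → φ x ≡ - r
    label-minimal {x} minx = inverseˡ-unique (φ x) r (begin
      φ x + r
        ≡⟨ cong₂ _+_ (sym (sumOver-singleton φ x)) (sym complementSum) ⟩
      sumOver P (singleton x) φ + sumOver P (complement P (singleton x)) φ
        ≡⟨ sumOver-complement φ (singleton x) ⟩
      sumℤ φ
        ≡⟨ proj₁ gorenstein ⟩
      + 0 ∎)
      where
      open ≡-Reasoning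
      complementSum : sumOver P (complement P (singleton x)) φ ≡ r
      complementSum = proj₂ gorenstein _
        (complement-singleton-isUpset minx) (dim-complement-singleton biconnected x)

    module _ (minOrMax : ∀ x → Minimal P x ⊎ Maximal P x) (r≢-r : r ≢ - r) where

      isMinimal≡not-isMaximal : ∀ x → isMinimal x ≡ not (isMaximal x)
      isMinimal≡not-isMaximal x = exactly-one⇒≡not
        (⊎-map (from (isMinimal⇔Minimal x)) (from (isMaximal⇔Maximal x)) (minOrMax x))
        λ (mi , ma) → r≢-r (trans (sym (label-maximal (to (isMaximal⇔Maximal x) ma)))
                                  (label-minimal (to (isMinimal⇔Minimal x) mi)))

      label≡± : ∀ x → φ x ≡ (if isMaximal x then r else - r)
      label≡± x with isMaximal x in maxx
      ... | true  = label-maximal (to (isMaximal⇔Maximal x) maxx)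
      ... | false = label-minimal
        (to (isMinimal⇔Minimal x) (trans (isMinimal≡not-isMaximal x) (cong not maxx)))

proposition6p2 : (P : FinPoset) → 2 ≤ FinPoset.n P → HasLength1 P → HasseBiconnected P
    → (r : ℕ) → 1 ≤ r
    → Σ (Fin (FinPoset.n P) → ℤ) (λ φ → IsGorensteinLabeling P (+ r) φ)
    → numMinimal P ≡ numMaximal P
proposition6p2 P _ (minOrMax , _) biconnected (ℕ.suc r) (s≤s z≤n) (φ , gorenstein) = begin
  countF (isMinimal P)        ≡⟨ countF-cong (isMinimal≡not-isMaximal minOrMax r≢-r) ⟩
  countF (not ∘ isMaximal P)  ≡⟨ sym (countF-balanced (isMaximal P) +[1+ r ] labelSum≡0) ⟩
  countF (isMaximal P)        ∎
  where
  open ≡-Reasoning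
  open GorensteinLabeling P biconnected gorenstein

  r≢-r : +[1+ r ] ≢ - +[1+ r ]
  r≢-r ()

  labelSum≡0 : sumℤ (λ x → if isMaximal P x then +[1+ r ] else - +[1+ r ]) ≡ + 0
  labelSum≡0 = trans (sumℤ-cong (sym ∘ label≡± minOrMax r≢-r)) (proj₁ gorenstein)
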